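{- If $(Q,\mathcal{B})$ is a nested SQS$(v)$ with exactly $\frac{v}{2}\left(\frac{v}{2}-1\right)$ ND-pairs, then $Q$ can be partitioned into two subsets $Q_1$ and $Q_2$, each of size $\frac{v}{2}$, such that the ND-pairs are exactly the pairs contained in $Q_1$ and the pairs contained in $Q_2$.
   Context: A Steiner quadruple system SQS$(v)$ is a pair $(Q,\mathcal{B})$ where $Q$ is a set of $v$ points and $\mathcal{B}$ is a collection of 4-subsets of $Q$ (blocks) such that every 3-subset of $Q$ is contained in exactly one block. A nested SQS$(v)$ is an SQS$(v)$ together with a partition of each block into two 2-subsets (pairs). A pair of points is an ND-pair if it is one of the two pairs in the partition of at least one block. -}

module Defs where

open import Data.Nat using (ℕ)
open import Data.Fin using (Fin; _<_)
open import Data.Fin.Properties using (_≟_; any?; _<?_)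
open import Data.Product using (_×_; _,_; ∃; Σ)
open import Data.Sum using (_⊎_)
open import Data.List using (List; length; filter; concatMap; map; allFin)
open import Relation.Binary.PropositionalEquality using (_≡_; _≢_)
open import Relation.Nullary using (Dec; ¬_)
open import Relation.Nullary.Decidable using (_×-dec_; _⊎-dec_)

-- A nested block on the point set Fin v: four distinct points a b c d,
-- i.e. the 4-subset {a,b,c,d}, partitioned into the pairs {a,b} and {c,d}.
record NBlock (v : ℕ) : Set where
  field
    a b c d : Fin v
    a≢b : a ≢ b
    a≢c : a ≢ c
    a≢d : a ≢ d
    b≢c : b ≢ c
    b≢d : b ≢ d
    c≢d : c ≢ d
open NBlock public

_∈B_ : ∀ {v} → Fin v → NBlock v → Set
x ∈B B = x ≡ a B ⊎ x ≡ b B ⊎ x ≡ c B ⊎ x ≡ d B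

SamePair : ∀ {v} → Fin v → Fin v → Fin v → Fin v → Set
SamePair x y p q = (x ≡ p × y ≡ q) ⊎ (x ≡ q × y ≡ p)

PairOf : ∀ {v} → Fin v → Fin v → NBlock v → Set
PairOf x y B = SamePair x y (a B) (b B) ⊎ SamePair x y (c B) (d B)

IsNestedSQS : (v m : ℕ) → (Fin m → NBlock v) → Set
IsNestedSQS v m Bs =
  (x y z : Fin v) → x ≢ y → x ≢ z → y ≢ z →
  ∃ λ i → (x ∈B Bs i × y ∈B Bs i × z ∈B Bs i) ×
          ((j : Fin m) → (x ∈B Bs j × y ∈B Bs j × z ∈B Bs j) → j ≡ i)

ND : ∀ {v m} → (Fin m → NBlock v) → Fin v → Fin v → Set
ND {m = m} Bs x y = ∃ λ (i : Fin m) → PairOf x y (Bs i)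

samePair? : ∀ {v} (x y p q : Fin v) → Dec (SamePair x y p q)
samePair? x y p q = ((x ≟ p) ×-dec (y ≟ q)) ⊎-dec ((x ≟ q) ×-dec (y ≟ p))

ND? : ∀ {v m} (Bs : Fin m → NBlock v) (x y : Fin v) → Dec (ND Bs x y)
ND? Bs x y = any? λ i → samePair? x y (a (Bs i)) (b (Bs i)) ⊎-dec samePair? x y (c (Bs i)) (d (Bs i))

pairs : (v : ℕ) → List (Fin v × Fin v)
pairs v = concatMap (λ x → map (λ y → (x , y)) (filter (λ y → x <? y) (allFin v))) (allFin v)

ndCount : ∀ {v m} → (Fin m → NBlock v) → ℕ
ndCount {v} Bs = length (filter (λ p → ND? Bs (Data.Product.proj₁ p) (Data.Product.proj₂ p)) (pairs v))

{-# OPTIONS --safe #-}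
module Submission where

-- The pairs that are not ND-pairs form a graph E on the v = 2n points, and E is
-- triangle-free: three points lie in a common block, and two of them form one of its two pairs.
-- Counting ordered pairs, E has (2n)² − 2n(n−1) − 2n = 2n² ordered edges, i.e. n² edges, which is
-- Mantel's bound; so E is complete bipartite with parts of size n, and those parts are Q₁ and Q₂.
-- For the equality case in Mantel's theorem take a vertex x₀ of maximal degree Δ, with r = v − Δ
-- non-neighbours.  Its neighbourhood is independent, so every edge has an end among the
-- non-neighbours, whence n² ≤ Σ_{x ∉ N(x₀)} deg x ≤ rΔ ≤ ((r + Δ)/2)² = n².  Equality throughout
-- forces Δ = r = n, no edges among the non-neighbours, and every non-neighbour to have degree Δ,
-- i.e. to be adjacent to every neighbour of x₀.  Q₁ is the neighbourhood of x₀.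

open import Defs
open import Data.Nat using (ℕ; _*_; _∸_)
open import Data.Fin using (Fin)
open import Data.Fin.Subset using (Subset; _∈_; ∁; ∣_∣)
open import Data.Product using (_×_; ∃)
open import Data.Sum using (_⊎_)
open import Function.Bundles using (_⇔_)
open import Relation.Binary.PropositionalEquality using (_≡_; _≢_)

open import Level using (Level; 0ℓ)
open import Data.Bool using (true; false; if_then_else_)
open import Data.Empty using (⊥)
open import Data.Fin using (zero; suc)
open import Data.Fin.Properties using (_≟_; _<?_; <-cmp; <-irrefl)
open import Data.Fin.Subset using () renaming (⊥ to ∅)
open import Data.Fin.Subset.Properties using (x∈∁p⇒x∉p; x∉p⇒x∈∁p; ∣∁p∣≡n∸∣p∣)
open import Data.List as List using (List; []; _∷_; length; filter; map; concatMap; allFin)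
open import Data.List.Extrema.Nat using (argmax; f[xs]≤f[argmax])
open import Data.List.Membership.Propositional.Properties using (∈-allFin)
open import Data.List.Properties using (filter-++; length-++)
import Data.List.Relation.Unary.All as All
open import Data.Nat using (zero; suc; _+_; _≤_; z≤n; s≤s; ∣_-_∣)
open import Data.Nat.Properties
  using ( ≤-refl; ≤-trans; ≤-reflexive; ≤-antisym; ≤-total; <⇒≱; ≮⇒≥; n≤0⇒n≡0; 0≢1+n
        ; +-comm; +-assoc; +-identityʳ; +-mono-≤; +-mono-<; +-monoˡ-≤; +-monoʳ-≤
        ; +-cancelˡ-≤; +-cancelʳ-≤; +-cancelˡ-≡; +-cancelʳ-≡; m≤m+n; m+n∸n≡m; m≤n⇒∃[o]m+o≡n
        ; *-comm; *-identityʳ; *-distribʳ-+; *-cancelˡ-≡; *-monoʳ-≤; m*n≡0⇒m≡0∨n≡0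
        ; ∣-∣-comm; ∣m-m+n∣≡n; ∣m-n∣≡0⇒m≡n; +-*-semiring; module ≤-Reasoning )
open import Algebra.Properties.Semiring.Sum +-*-semiring
  using (sum; sum-syntax; sum-cong-≗; sum-replicate-zero; ∑-distrib-+; ∑-comm; *-distribˡ-sum; *-distribʳ-sum)
open import Data.Nat.Tactic.RingSolver using (solve-∀)
open import Data.Product using (_,_; proj₁; proj₂)
import Data.Product as Product
open import Data.Sum using (inj₁; inj₂; [_,_]; reduce; assocˡ)
import Data.Sum as Sum
open import Data.Vec using (tabulate)
open import Data.Vec.Properties using ([]=⇒lookup; lookup⇒[]=; lookup∘tabulate)
open import Function using (_∘_; id)
open import Function.Bundles using (mk⇔; Equivalence)
open import Function.Construct.Composition using (_⇔-∘_)
open import Relation.Binary using (Rel; Symmetric; Decidable; tri<; tri≈; tri>)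
open import Relation.Binary.PropositionalEquality
  using (refl; sym; trans; cong; cong₂; subst; module ≡-Reasoning)
open import Relation.Nullary using (Dec; yes; no; does; ¬_; ¬?; contradiction)
open import Relation.Nullary.Decidable using (dec-true; dec-false; does-⇔; decidable-stable; _×-dec_)
open import Relation.Unary using (Pred)
import Relation.Unary as U

private
  variable
    ℓ ℓ₁ ℓ₂ : Level
    A : Set ℓ₁
    B : Set ℓ₂

does≡true⇒ : (a? : Dec A) → does a? ≡ true → A
does≡true⇒ (yes a) _  = a
does≡true⇒ (no _)  ()

𝟙 : Dec A → ℕ
𝟙 a? = if does a? then 1 else 0

𝟙-yes : (a? : Dec A) → A → 𝟙 a? ≡ 1
𝟙-yes a? a rewrite dec-true a? a = refl

𝟙-no : (a? : Dec A) → ¬ A → 𝟙 a? ≡ 0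
𝟙-no a? ¬a rewrite dec-false a? ¬a = refl

𝟙-cong : A ⇔ B → (a? : Dec A) (b? : Dec B) → 𝟙 a? ≡ 𝟙 b?
𝟙-cong A⇔B a? b? rewrite does-⇔ A⇔B a? b? = refl

𝟙+𝟙¬≡1 : (a? : Dec A) → 𝟙 a? + 𝟙 (¬? a?) ≡ 1
𝟙+𝟙¬≡1 (yes _) = refl
𝟙+𝟙¬≡1 (no _)  = refl

∑-const : ∀ n c → ∑[ i < n ] c ≡ n * c
∑-const zero    c = refl
∑-const (suc n) c = cong (c +_) (∑-const n c)

∑-1≡n : ∀ n → ∑[ i < n ] 1 ≡ n
∑-1≡n n = trans (∑-const n 1) (*-identityʳ n)

∑-mono-≤ : ∀ {n} {f g : Fin n → ℕ} → (∀ i → f i ≤ g i) → sum f ≤ sum g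
∑-mono-≤ {zero}  f≤g = z≤n
∑-mono-≤ {suc n} f≤g = +-mono-≤ (f≤g zero) (∑-mono-≤ (f≤g ∘ suc))

∑-mono-≤-tight : ∀ {n} {f g : Fin n → ℕ} → (∀ i → f i ≤ g i) → sum g ≤ sum f → ∀ i → f i ≡ g i
∑-mono-≤-tight {suc n} {f} {g} f≤g ∑g≤∑f zero =
  ≤-antisym (f≤g zero) (+-cancelʳ-≤ (sum (g ∘ suc)) (g zero) (f zero)
    (≤-trans ∑g≤∑f (+-monoʳ-≤ (f zero) (∑-mono-≤ (f≤g ∘ suc)))))
∑-mono-≤-tight {suc n} {f} {g} f≤g ∑g≤∑f (suc i) =
  ∑-mono-≤-tight (f≤g ∘ suc) (+-cancelˡ-≤ (g zero) _ _
    (≤-trans ∑g≤∑f (+-monoˡ-≤ (sum (f ∘ suc)) (f≤g zero)))) i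

∑∑-distrib-+ : ∀ {m n} (f g : Fin m → Fin n → ℕ) →
  ∑[ i < m ] ∑[ j < n ] (f i j + g i j) ≡ ∑[ i < m ] ∑[ j < n ] f i j + ∑[ i < m ] ∑[ j < n ] g i j
∑∑-distrib-+ {n = n} f g =
  trans (sum-cong-≗ (λ i → ∑-distrib-+ (f i) (g i))) (∑-distrib-+ (λ i → ∑[ j < n ] f i j) (λ i → ∑[ j < n ] g i j))

∑-𝟙-≟ : ∀ {n} (x : Fin n) → ∑[ y < n ] 𝟙 (x ≟ y) ≡ 1
∑-𝟙-≟ {suc n} zero    = cong suc (sum-replicate-zero n)
∑-𝟙-≟         (suc x) = ∑-𝟙-≟ x

𝟙<+𝟙>≡1 : ∀ {n} {x y : Fin n} → x ≢ y → 𝟙 (x <? y) + 𝟙 (y <? x) ≡ 1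
𝟙<+𝟙>≡1 {x = x} {y} x≢y with <-cmp x y
... | tri< x<y _ y≮x = cong₂ _+_ (𝟙-yes (x <? y) x<y) (𝟙-no (y <? x) y≮x)
... | tri≈ _ x≡y _   = contradiction x≡y x≢y
... | tri> x≮y _ y<x = cong₂ _+_ (𝟙-no (x <? y) x≮y) (𝟙-yes (y <? x) y<x)

module _ {P : Pred A ℓ} (P? : U.Decidable P) where

  length-filter-concatMap-tabulate : ∀ {n} (F : B → List A) (g : Fin n → B) →
    length (filter P? (concatMap F (List.tabulate g))) ≡ ∑[ i < n ] length (filter P? (F (g i)))
  length-filter-concatMap-tabulate {n = zero}  F g = refl
  length-filter-concatMap-tabulate {n = suc n} F g =
    trans (cong length (filter-++ P? (F (g zero)) _))
      (trans (length-++ (filter P? (F (g zero))))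
        (cong (length (filter P? (F (g zero))) +_) (length-filter-concatMap-tabulate F (g ∘ suc))))

  length-filter-map : (f : B → A) (xs : List B) →
    length (filter P? (map f xs)) ≡ length (filter (P? ∘ f) xs)
  length-filter-map f []       = refl
  length-filter-map f (x ∷ xs) with does (P? (f x))
  ... | true  = cong suc (length-filter-map f xs)
  ... | false = length-filter-map f xs

  length-filter-filter-tabulate : ∀ {Q : Pred A ℓ₂} (Q? : U.Decidable Q) {n} (g : Fin n → A) →
    length (filter P? (filter Q? (List.tabulate g))) ≡ ∑[ i < n ] (𝟙 (Q? (g i)) * 𝟙 (P? (g i)))
  length-filter-filter-tabulate Q? {zero}  g = refl
  length-filter-filter-tabulate Q? {suc n} g with does (Q? (g zero))
  ... | false = length-filter-filter-tabulate Q? (g ∘ suc)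
  ... | true with does (P? (g zero))
  ...   | true  = cong suc (length-filter-filter-tabulate Q? (g ∘ suc))
  ...   | false = length-filter-filter-tabulate Q? (g ∘ suc)

toSubset : ∀ {n} {P : Pred (Fin n) ℓ} → U.Decidable P → Subset n
toSubset P? = tabulate (does ∘ P?)

module _ {n} {P : Pred (Fin n) ℓ} (P? : U.Decidable P) where

  ∈-toSubset : ∀ {x} → x ∈ toSubset P? ⇔ P x
  ∈-toSubset {x} = mk⇔
    (λ x∈ → does≡true⇒ (P? x) (trans (sym (lookup∘tabulate (does ∘ P?) x)) ([]=⇒lookup x∈)))
    (λ Px → lookup⇒[]= x _ (trans (lookup∘tabulate (does ∘ P?) x) (dec-true (P? x) Px)))

  ∈∁-toSubset : ∀ {x} → x ∈ ∁ (toSubset P?) ⇔ (¬ P x)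
  ∈∁-toSubset = mk⇔ (λ x∈∁ Px → x∈∁p⇒x∉p x∈∁ (Equivalence.from ∈-toSubset Px))
                    (λ ¬Px → x∉p⇒x∈∁p (¬Px ∘ Equivalence.to ∈-toSubset))

∣toSubset∣≡∑𝟙 : ∀ {n} {P : Pred (Fin n) ℓ} (P? : U.Decidable P) → ∣ toSubset P? ∣ ≡ ∑[ i < n ] 𝟙 (P? i)
∣toSubset∣≡∑𝟙 {n = zero}  P? = refl
∣toSubset∣≡∑𝟙 {n = suc n} P? with does (P? zero)
... | true  = cong suc (∣toSubset∣≡∑𝟙 (P? ∘ suc))
... | false = ∣toSubset∣≡∑𝟙 (P? ∘ suc)

m+n≡o+o⇒m*n+∣m-o∣*∣m-o∣≡o*o : ∀ m n o → m + n ≡ o + o → m * n + ∣ m - o ∣ * ∣ m - o ∣ ≡ o * o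
m+n≡o+o⇒m*n+∣m-o∣*∣m-o∣≡o*o m n o eq with ≤-total m o
... | inj₁ m≤o with m≤n⇒∃[o]m+o≡n m≤o
...   | d , refl with +-cancelˡ-≡ m n (d + (m + d)) (trans eq (+-assoc m d (m + d)))
...     | refl rewrite ∣m-m+n∣≡n m d = below m d
  where
  below : ∀ m d → m * (d + (m + d)) + d * d ≡ (m + d) * (m + d)
  below = solve-∀
m+n≡o+o⇒m*n+∣m-o∣*∣m-o∣≡o*o m n o eq | inj₂ o≤m with m≤n⇒∃[o]m+o≡n o≤m
...   | d , refl with +-cancelˡ-≡ o (d + n) o (trans (sym (+-assoc o d n)) eq)
...     | refl rewrite ∣-∣-comm (d + n + d) (d + n) | ∣m-m+n∣≡n (d + n) d = above n d
  where
  above : ∀ n d → (d + n + d) * n + d * d ≡ (d + n) * (d + n)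
  above = solve-∀

m+n≡o+o⇒m*n≤o*o : ∀ m n o → m + n ≡ o + o → m * n ≤ o * o
m+n≡o+o⇒m*n≤o*o m n o eq =
  subst (m * n ≤_) (m+n≡o+o⇒m*n+∣m-o∣*∣m-o∣≡o*o m n o eq) (m≤m+n (m * n) _)

m+n≡o+o∧o*o≤m*n⇒m≡o : ∀ m n o → m + n ≡ o + o → o * o ≤ m * n → m ≡ o
m+n≡o+o∧o*o≤m*n⇒m≡o m n o eq o*o≤m*n =
  ∣m-n∣≡0⇒m≡n (reduce (m*n≡0⇒m≡0∨n≡0 ∣ m - o ∣ (n≤0⇒n≡0 deviation²≤0)))
  where
  deviation²≤0 : ∣ m - o ∣ * ∣ m - o ∣ ≤ 0
  deviation²≤0 = +-cancelˡ-≤ (m * n) _ 0 (≤-trans (≤-reflexive (m+n≡o+o⇒m*n+∣m-o∣*∣m-o∣≡o*o m n o eq))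
                   (≤-trans o*o≤m*n (≤-reflexive (sym (+-identityʳ (m * n))))))

m+m≤n+n⇒m≤n : ∀ {m n} → m + m ≤ n + n → m ≤ n
m+m≤n+n⇒m≤n m+m≤n+n = ≮⇒≥ λ n<m → <⇒≱ (+-mono-< n<m n<m) m+m≤n+n

SameSide : ∀ {n} → Subset n → Rel (Fin n) 0ℓ
SameSide Q x y = (x ∈ Q × y ∈ Q) ⊎ (x ∈ ∁ Q × y ∈ ∁ Q)

module TriangleFree {v} {E : Rel (Fin v) ℓ} (E? : Decidable E) (E-sym : Symmetric E)
                    (triangle-free : ∀ {x y z} → E x y → E y z → E x z → ⊥) where

  deg : Fin v → ℕ
  deg x = ∑[ y < v ] 𝟙 (E? x y)

  ∑-column≡deg : ∀ y → ∑[ x < v ] 𝟙 (E? x y) ≡ deg y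
  ∑-column≡deg y = sum-cong-≗ λ x → 𝟙-cong (mk⇔ E-sym E-sym) (E? x y) (E? y x)

  nbhd : Fin v → Subset v
  nbhd x = toSubset (E? x)

  max-degree-vertex : Fin v → ∃ λ x₀ → ∀ x → deg x ≤ deg x₀
  max-degree-vertex x =
    argmax deg x (allFin v) , λ y → All.lookup (f[xs]≤f[argmax] {f = deg} x (allFin v)) (∈-allFin y)

  module MaxDegree (x₀ : Fin v) (x₀-max : ∀ x → deg x ≤ deg x₀) where

    Δ : ℕ
    Δ = deg x₀

    far : Fin v → ℕ
    far y = 𝟙 (¬? (E? x₀ y))

    r : ℕ
    r = ∑[ y < v ] far y

    Δ+r≡v : Δ + r ≡ v
    Δ+r≡v = begin
      Δ + r                               ≡⟨ ∑-distrib-+ (λ y → 𝟙 (E? x₀ y)) far ⟨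
      ∑[ y < v ] (𝟙 (E? x₀ y) + far y)    ≡⟨ sum-cong-≗ (λ y → 𝟙+𝟙¬≡1 (E? x₀ y)) ⟩
      ∑[ y < v ] 1                        ≡⟨ ∑-1≡n v ⟩
      v                                   ∎
      where open ≡-Reasoning

    far-ends : Fin v → Fin v → ℕ
    far-ends x y = far x * 𝟙 (E? x y) + far y * 𝟙 (E? x y)

    𝟙≤far-ends : ∀ x y → 𝟙 (E? x y) ≤ far-ends x y
    𝟙≤far-ends x y with E? x y | E? x₀ x | E? x₀ y
    ... | no _    | _       | _       = z≤n
    ... | yes _   | no _    | _       = s≤s z≤n
    ... | yes _   | yes _   | no _    = ≤-refl
    ... | yes Exy | yes Ex₀x | yes Ex₀y = contradiction Ex₀y (triangle-free Ex₀x Exy)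

    far-deg : ℕ
    far-deg = ∑[ x < v ] (far x * deg x)

    ∑∑far-ends≡ : ∑[ x < v ] ∑[ y < v ] far-ends x y ≡ far-deg + far-deg
    ∑∑far-ends≡ = begin
      ∑[ x < v ] ∑[ y < v ] far-ends x y
        ≡⟨ ∑∑-distrib-+ (λ x y → far x * 𝟙 (E? x y)) (λ x y → far y * 𝟙 (E? x y)) ⟩
      ∑[ x < v ] ∑[ y < v ] (far x * 𝟙 (E? x y)) + ∑[ x < v ] ∑[ y < v ] (far y * 𝟙 (E? x y))
        ≡⟨ cong (∑[ x < v ] ∑[ y < v ] (far x * 𝟙 (E? x y)) +_) (∑-comm (λ x y → far y * 𝟙 (E? x y))) ⟩
      ∑[ x < v ] ∑[ y < v ] (far x * 𝟙 (E? x y)) + ∑[ y < v ] ∑[ x < v ] (far y * 𝟙 (E? x y))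
        ≡⟨ cong₂ _+_ (sum-cong-≗ λ x → *-distribˡ-sum (far x) (λ y → 𝟙 (E? x y)))
                     (sum-cong-≗ λ y → *-distribˡ-sum (far y) (λ x → 𝟙 (E? x y))) ⟨
      ∑[ x < v ] (far x * deg x) + ∑[ y < v ] (far y * ∑[ x < v ] 𝟙 (E? x y))
        ≡⟨ cong (far-deg +_) (sum-cong-≗ λ y → cong (far y *_) (∑-column≡deg y)) ⟩
      far-deg + far-deg
        ∎
      where open ≡-Reasoning

    far-deg≤r*Δ : far-deg ≤ r * Δ
    far-deg≤r*Δ = ≤-trans (∑-mono-≤ λ x → *-monoʳ-≤ (far x) (x₀-max x))
                          (≤-reflexive (sym (*-distribʳ-sum Δ far)))

    module Extremal {n} (v≡n+n : v ≡ n + n) (∑deg≡ : ∑[ x < v ] deg x ≡ n * n + n * n) where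

      r*Δ≤n*n : r * Δ ≤ n * n
      r*Δ≤n*n = m+n≡o+o⇒m*n≤o*o r Δ n (trans (+-comm r Δ) (trans Δ+r≡v v≡n+n))

      ∑deg≤2far-deg : ∑[ x < v ] deg x ≤ far-deg + far-deg
      ∑deg≤2far-deg = ≤-trans (∑-mono-≤ λ x → ∑-mono-≤ (𝟙≤far-ends x)) (≤-reflexive ∑∑far-ends≡)

      n*n≤Δ*r : n * n ≤ Δ * r
      n*n≤Δ*r = subst (n * n ≤_) (*-comm r Δ) (m+m≤n+n⇒m≤n (begin
        n * n + n * n        ≡⟨ ∑deg≡ ⟨
        ∑[ x < v ] deg x     ≤⟨ ∑deg≤2far-deg ⟩
        far-deg + far-deg    ≤⟨ +-mono-≤ far-deg≤r*Δ far-deg≤r*Δ ⟩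
        r * Δ + r * Δ        ∎))
        where open ≤-Reasoning

      r*Δ≤far-deg : r * Δ ≤ far-deg
      r*Δ≤far-deg = m+m≤n+n⇒m≤n (begin
        r * Δ + r * Δ        ≤⟨ +-mono-≤ r*Δ≤n*n r*Δ≤n*n ⟩
        n * n + n * n        ≡⟨ ∑deg≡ ⟨
        ∑[ x < v ] deg x     ≤⟨ ∑deg≤2far-deg ⟩
        far-deg + far-deg    ∎)
        where open ≤-Reasoning

      ∑∑far-ends≤∑deg : ∑[ x < v ] ∑[ y < v ] far-ends x y ≤ ∑[ x < v ] deg x
      ∑∑far-ends≤∑deg = begin
        ∑[ x < v ] ∑[ y < v ] far-ends x y  ≡⟨ ∑∑far-ends≡ ⟩
        far-deg + far-deg                   ≤⟨ +-mono-≤ far-deg≤r*Δ far-deg≤r*Δ ⟩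
        r * Δ + r * Δ                       ≤⟨ +-mono-≤ r*Δ≤n*n r*Δ≤n*n ⟩
        n * n + n * n                       ≡⟨ ∑deg≡ ⟨
        ∑[ x < v ] deg x                    ∎
        where open ≤-Reasoning

      Δ≡n : Δ ≡ n
      Δ≡n = m+n≡o+o∧o*o≤m*n⇒m≡o Δ r n (trans Δ+r≡v v≡n+n) n*n≤Δ*r

      𝟙≡far-ends : ∀ x y → 𝟙 (E? x y) ≡ far-ends x y
      𝟙≡far-ends x = ∑-mono-≤-tight (𝟙≤far-ends x)
        (≤-reflexive (sym (∑-mono-≤-tight (λ x → ∑-mono-≤ (𝟙≤far-ends x)) ∑∑far-ends≤∑deg x)))

      far*deg≡far*Δ : ∀ x → far x * deg x ≡ far x * Δ
      far*deg≡far*Δ = ∑-mono-≤-tight (λ x → *-monoʳ-≤ (far x) (x₀-max x))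
        (≤-trans (≤-reflexive (sym (*-distribʳ-sum Δ far))) r*Δ≤far-deg)

      near-independent : ∀ {x y} → E x₀ x → E x₀ y → ¬ E x y
      near-independent Ex₀x Ex₀y Exy = triangle-free Ex₀x Exy Ex₀y

      far-independent : ∀ {x y} → ¬ E x₀ x → ¬ E x₀ y → ¬ E x y
      far-independent {x} {y} ¬Ex₀x ¬Ex₀y Exy with E? x y | E? x₀ x | E? x₀ y | 𝟙≡far-ends x y
      ... | no ¬Exy | _         | _         | _  = ¬Exy Exy
      ... | _       | yes Ex₀x  | _         | _  = ¬Ex₀x Ex₀x
      ... | _       | _         | yes Ex₀y  | _  = ¬Ex₀y Ex₀y
      ... | yes _   | no _      | no _      | ()

      far-deg≡Δ : ∀ {x} → ¬ E x₀ x → deg x ≡ Δ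
      far-deg≡Δ {x} ¬Ex₀x = *-cancelˡ-≡ (deg x) Δ 1
        (subst (λ k → k * deg x ≡ k * Δ) (𝟙-yes (¬? (E? x₀ x)) ¬Ex₀x) (far*deg≡far*Δ x))

      far-adjacent-near : ∀ {x y} → ¬ E x₀ x → E x₀ y → E x y
      far-adjacent-near {x} {y} ¬Ex₀x Ex₀y = decidable-stable (E? x y) λ ¬Exy →
        0≢1+n (trans (sym (𝟙-no (E? x y) ¬Exy)) (trans (row≡ y) (𝟙-yes (E? x₀ y) Ex₀y)))
        where
        row≤ : ∀ y → 𝟙 (E? x y) ≤ 𝟙 (E? x₀ y)
        row≤ y with E? x y | E? x₀ y
        ... | no _    | _        = z≤n
        ... | yes _   | yes _    = ≤-refl
        ... | yes Exy | no ¬Ex₀y = contradiction Exy (far-independent ¬Ex₀x ¬Ex₀y)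

        row≡ : ∀ y → 𝟙 (E? x y) ≡ 𝟙 (E? x₀ y)
        row≡ = ∑-mono-≤-tight row≤ (≤-reflexive (sym (far-deg≡Δ ¬Ex₀x)))

      ¬E⇔SameSide : ∀ x y → (¬ E x y) ⇔ SameSide (nbhd x₀) x y
      ¬E⇔SameSide x y = mk⇔ ¬E⇒SameSide SameSide⇒¬E
        where
        open Equivalence
        ¬E⇒SameSide : ¬ E x y → SameSide (nbhd x₀) x y
        ¬E⇒SameSide ¬Exy with E? x₀ x | E? x₀ y
        ... | yes Ex₀x  | yes Ex₀y  = inj₁ (from (∈-toSubset (E? x₀)) Ex₀x , from (∈-toSubset (E? x₀)) Ex₀y)
        ... | no ¬Ex₀x  | no ¬Ex₀y  = inj₂ (from (∈∁-toSubset (E? x₀)) ¬Ex₀x , from (∈∁-toSubset (E? x₀)) ¬Ex₀y)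
        ... | yes Ex₀x  | no ¬Ex₀y  = contradiction (E-sym (far-adjacent-near ¬Ex₀y Ex₀x)) ¬Exy
        ... | no ¬Ex₀x  | yes Ex₀y  = contradiction (far-adjacent-near ¬Ex₀x Ex₀y) ¬Exy
        SameSide⇒¬E : SameSide (nbhd x₀) x y → ¬ E x y
        SameSide⇒¬E (inj₁ (x∈ , y∈))   = near-independent (to (∈-toSubset (E? x₀)) x∈) (to (∈-toSubset (E? x₀)) y∈)
        SameSide⇒¬E (inj₂ (x∈∁ , y∈∁)) = far-independent (to (∈∁-toSubset (E? x₀)) x∈∁) (to (∈∁-toSubset (E? x₀)) y∈∁)

      ∣nbhd∣≡n : ∣ nbhd x₀ ∣ ≡ n
      ∣nbhd∣≡n = trans (∣toSubset∣≡∑𝟙 (E? x₀)) Δ≡n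

      ∣∁nbhd∣≡n : ∣ ∁ (nbhd x₀) ∣ ≡ n
      ∣∁nbhd∣≡n = trans (∣∁p∣≡n∸∣p∣ (nbhd x₀)) (trans (cong₂ _∸_ v≡n+n ∣nbhd∣≡n) (m+n∸n≡m n n))

Complement : ∀ {n} → Rel (Fin n) ℓ → Rel (Fin n) ℓ
Complement R x y = x ≢ y × ¬ R x y

complement-sym : ∀ {n} {R : Rel (Fin n) ℓ} → Symmetric R → Symmetric (Complement R)
complement-sym R-sym (x≢y , ¬Rxy) = x≢y ∘ sym , ¬Rxy ∘ R-sym

module _ {v} {R : Rel (Fin v) ℓ} (R? : Decidable R) where

  complement? : Decidable (Complement R)
  complement? x y = ¬? (x ≟ y) ×-dec ¬? (R? x y)

  ⇔¬complement : ∀ {x y} → x ≢ y → R x y ⇔ (¬ Complement R x y)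
  ⇔¬complement {x} {y} x≢y = mk⇔ (λ Rxy (_ , ¬Rxy) → ¬Rxy Rxy)
                                 (λ ¬c → decidable-stable (R? x y) λ ¬Rxy → ¬c (x≢y , ¬Rxy))

  -- ndCount Bs is pairCount (ND? Bs).
  pairCount : ℕ
  pairCount = length (filter (λ p → R? (proj₁ p) (proj₂ p)) (pairs v))

  pairCount≡∑∑< : pairCount ≡ ∑[ x < v ] ∑[ y < v ] (𝟙 (x <? y) * 𝟙 (R? x y))
  pairCount≡∑∑< = trans (length-filter-concatMap-tabulate R?₂ row id) (sum-cong-≗ λ x →
    trans (length-filter-map R?₂ (x ,_) (filter (x <?_) (allFin v)))
          (length-filter-filter-tabulate (R? x) (x <?_) id))
    where
    R?₂ : U.Decidable (λ (p : Fin v × Fin v) → R (proj₁ p) (proj₂ p))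
    R?₂ p = R? (proj₁ p) (proj₂ p)
    row : Fin v → List (Fin v × Fin v)
    row x = map (x ,_) (filter (x <?_) (allFin v))

  module _ (R-sym : Symmetric R) where

    pairCount≡∑∑> : pairCount ≡ ∑[ x < v ] ∑[ y < v ] (𝟙 (y <? x) * 𝟙 (R? x y))
    pairCount≡∑∑> = trans pairCount≡∑∑< (trans (∑-comm (λ x y → 𝟙 (x <? y) * 𝟙 (R? x y)))
      (sum-cong-≗ λ x → sum-cong-≗ λ y → cong (𝟙 (y <? x) *_) (𝟙-cong (mk⇔ R-sym R-sym) (R? y x) (R? x y))))

    ordered-pair-partition : ∀ x y →
      𝟙 (complement? x y) + ((𝟙 (x <? y) + 𝟙 (y <? x)) * 𝟙 (R? x y) + 𝟙 (x ≟ y)) ≡ 1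
    ordered-pair-partition x y with x ≟ y
    ... | yes refl = cong (λ k → 0 + ((k + k) * 𝟙 (R? x x) + 1)) (𝟙-no (x <? x) (<-irrefl refl))
    ... | no x≢y with R? x y
    ...   | yes _ = cong (λ k → 0 + (k * 1 + 0)) (𝟙<+𝟙>≡1 x≢y)
    ...   | no _  = cong (λ k → 1 + (k * 0 + 0)) (𝟙<+𝟙>≡1 x≢y)

    ∑∑-complement : ∑[ x < v ] ∑[ y < v ] 𝟙 (complement? x y) + (pairCount + pairCount + v) ≡ v * v
    ∑∑-complement = begin
      ∑∑ C + (pairCount + pairCount + v)  ≡⟨ cong₂ (λ p d → ∑∑ C + (p + d)) 2pairCount≡∑∑T (sym ∑∑D≡v) ⟩
      ∑∑ C + (∑∑ T + ∑∑ D)                ≡⟨ cong (∑∑ C +_) (∑∑-distrib-+ T D) ⟨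
      ∑∑ C + ∑∑ (λ x y → T x y + D x y)   ≡⟨ ∑∑-distrib-+ C (λ x y → T x y + D x y) ⟨
      ∑∑ (λ x y → C x y + (T x y + D x y)) ≡⟨ sum-cong-≗ (λ x → sum-cong-≗ (ordered-pair-partition x)) ⟩
      ∑∑ (λ _ _ → 1)                      ≡⟨ sum-cong-≗ {v} (λ _ → ∑-1≡n v) ⟩
      ∑[ x < v ] v                        ≡⟨ ∑-const v v ⟩
      v * v                               ∎
      where
      open ≡-Reasoning
      ∑∑ : (Fin v → Fin v → ℕ) → ℕ
      ∑∑ f = ∑[ x < v ] ∑[ y < v ] f x y
      C T D : Fin v → Fin v → ℕ
      C x y = 𝟙 (complement? x y)
      T x y = (𝟙 (x <? y) + 𝟙 (y <? x)) * 𝟙 (R? x y)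
      D x y = 𝟙 (x ≟ y)
      2pairCount≡∑∑T : pairCount + pairCount ≡ ∑∑ T
      2pairCount≡∑∑T = trans (cong₂ _+_ pairCount≡∑∑< pairCount≡∑∑>)
        (trans (sym (∑∑-distrib-+ (λ x y → 𝟙 (x <? y) * 𝟙 (R? x y)) (λ x y → 𝟙 (y <? x) * 𝟙 (R? x y))))
          (sum-cong-≗ λ x → sum-cong-≗ λ y → sym (*-distribʳ-+ (𝟙 (R? x y)) (𝟙 (x <? y)) (𝟙 (y <? x)))))
      ∑∑D≡v : ∑∑ D ≡ v
      ∑∑D≡v = trans (sum-cong-≗ {v} ∑-𝟙-≟) (∑-1≡n v)

SamePair-sym : ∀ {v} {x y p q : Fin v} → SamePair x y p q → SamePair y x p q
SamePair-sym = Sum.swap ∘ Sum.map Product.swap Product.swap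

ND-sym : ∀ {v m} (Bs : Fin m → NBlock v) → Symmetric (ND Bs)
ND-sym Bs (i , xy∈Bᵢ) = i , Sum.map SamePair-sym SamePair-sym xy∈Bᵢ

distinct-in-pair : ∀ {v} {x y p q : Fin v} → x ≡ p ⊎ x ≡ q → y ≡ p ⊎ y ≡ q → x ≢ y → SamePair x y p q
distinct-in-pair (inj₁ refl) (inj₁ refl) x≢y = contradiction refl x≢y
distinct-in-pair (inj₁ x≡p)  (inj₂ y≡q)  _   = inj₁ (x≡p , y≡q)
distinct-in-pair (inj₂ x≡q)  (inj₁ y≡p)  _   = inj₂ (x≡q , y≡p)
distinct-in-pair (inj₂ refl) (inj₂ refl) x≢y = contradiction refl x≢y

-- Pigeonhole: two of the three points lie in the same half {a,b} or {c,d} of the block.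
three-points-contain-pair : ∀ {v} (B : NBlock v) {x y z : Fin v} → x ≢ y → x ≢ z → y ≢ z →
  x ∈B B → y ∈B B → z ∈B B → PairOf x y B ⊎ PairOf x z B ⊎ PairOf y z B
three-points-contain-pair B x≢y x≢z y≢z x∈B y∈B z∈B with assocˡ x∈B | assocˡ y∈B | assocˡ z∈B
... | inj₁ x∈ab | inj₁ y∈ab | _         = inj₁ (inj₁ (distinct-in-pair x∈ab y∈ab x≢y))
... | inj₂ x∈cd | inj₂ y∈cd | _         = inj₁ (inj₂ (distinct-in-pair x∈cd y∈cd x≢y))
... | inj₁ x∈ab | inj₂ _    | inj₁ z∈ab = inj₂ (inj₁ (inj₁ (distinct-in-pair x∈ab z∈ab x≢z)))
... | inj₂ x∈cd | inj₁ _    | inj₂ z∈cd = inj₂ (inj₁ (inj₂ (distinct-in-pair x∈cd z∈cd x≢z)))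
... | inj₂ _    | inj₁ y∈ab | inj₁ z∈ab = inj₂ (inj₂ (inj₁ (distinct-in-pair y∈ab z∈ab y≢z)))
... | inj₁ _    | inj₂ y∈cd | inj₂ z∈cd = inj₂ (inj₂ (inj₂ (distinct-in-pair y∈cd z∈cd y≢z)))

complement-ND-triangle-free : ∀ {v m} (Bs : Fin m → NBlock v) → IsNestedSQS v m Bs → ∀ {x y z} →
  Complement (ND Bs) x y → Complement (ND Bs) y z → Complement (ND Bs) x z → ⊥
complement-ND-triangle-free Bs sqs (x≢y , ¬NDxy) (y≢z , ¬NDyz) (x≢z , ¬NDxz)
  with sqs _ _ _ x≢y x≢z y≢z
... | i , (x∈Bᵢ , y∈Bᵢ , z∈Bᵢ) , _ =
  [ ¬NDxy ∘ (i ,_) , [ ¬NDxz ∘ (i ,_) , ¬NDyz ∘ (i ,_) ] ]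
    (three-points-contain-pair (Bs i) x≢y x≢z y≢z x∈Bᵢ y∈Bᵢ z∈Bᵢ)

c+[2n[n∸1]+2n]≡2n*2n⇒c≡n*n+n*n : ∀ n c →
  c + (n * (n ∸ 1) + n * (n ∸ 1) + 2 * n) ≡ 2 * n * (2 * n) → c ≡ n * n + n * n
c+[2n[n∸1]+2n]≡2n*2n⇒c≡n*n+n*n zero    c eq = trans (sym (+-identityʳ c)) eq
c+[2n[n∸1]+2n]≡2n*2n⇒c≡n*n+n*n (suc k) c eq = +-cancelʳ-≡ _ c _ (trans eq (sym (expand k)))
  where
  expand : ∀ k → suc k * suc k + suc k * suc k + (suc k * k + suc k * k + 2 * suc k)
                 ≡ 2 * suc k * (2 * suc k)
  expand = solve-∀

lemma2p6 : (v n m : ℕ) → v ≡ 2 * n → (Bs : Fin m → NBlock v) → IsNestedSQS v m Bs →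
    ndCount Bs ≡ n * (n ∸ 1) →
    ∃ λ (Q₁ : Subset v) → ∣ Q₁ ∣ ≡ n × ∣ ∁ Q₁ ∣ ≡ n ×
      ((x y : Fin v) → x ≢ y →
        (ND Bs x y ⇔ ((x ∈ Q₁ × y ∈ Q₁) ⊎ (x ∈ ∁ Q₁ × y ∈ ∁ Q₁))))
lemma2p6 .0 zero m refl Bs sqs ndCount≡ = ∅ , refl , refl , λ ()
lemma2p6 .(2 * suc k) (suc k) m refl Bs sqs ndCount≡ =
  nbhd x₀ , ∣nbhd∣≡n , ∣∁nbhd∣≡n , λ x y x≢y → ¬E⇔SameSide x y ⇔-∘ ⇔¬complement (ND? Bs) x≢y
  where
  n = suc k
  open TriangleFree (complement? (ND? Bs)) (complement-sym (ND-sym Bs)) (complement-ND-triangle-free Bs sqs)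
  x₀ : Fin (2 * n)
  x₀ = proj₁ (max-degree-vertex zero)
  open MaxDegree x₀ (proj₂ (max-degree-vertex zero))
  ∑deg≡ : ∑[ x < 2 * n ] deg x ≡ n * n + n * n
  ∑deg≡ = c+[2n[n∸1]+2n]≡2n*2n⇒c≡n*n+n*n n _
    (subst (λ p → ∑[ x < 2 * n ] deg x + (p + p + 2 * n) ≡ 2 * n * (2 * n)) ndCount≡
      (∑∑-complement (ND? Bs) (ND-sym Bs)))
  open Extremal {n} (cong (n +_) (+-identityʳ n)) ∑deg≡
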